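{- There is an algorithm which, given a propositional Hilbert-type calculus $\mathbf{C}$ and a finite-valued logic $\mathbf{M}$ over the same finite propositional language, decides whether $\mathbf{C}$ is t-sound for $\mathbf{M}$.
   Context: A propositional language has variables $X_1,X_2,\dots$ and finitely many connectives with fixed arities. A substitution maps variables to formulas; $F\sigma$ is the result of simultaneously replacing each variable $X$ in $F$ by $\sigma(X)$. A propositional Hilbert-type calculus $\mathbf{C}$ consists of a finite set of axioms (formulas) and a finite set of rules, each rule having premises $A_1,\dots,A_n$ and a conclusion $C$ (formulas). A finite-valued logic $\mathbf{M}$ consists of a finite set $V(\mathbf{M})$ of truth values, a subset $V^+(\mathbf{M})$ of designated values, and a truth function $V(\mathbf{M})^n\to V(\mathbf{M})$ for each $n$-ary connective; a valuation maps variables to truth values and extends to formulas; a tautology is a formula to which every valuation assigns a designated value. $\mathbf{C}$ is t-sound for $\mathbf{M}$ if every axiom of $\mathbf{C}$ is a tautology of $\mathbf{M}$ and, for every rule of $\mathbf{C}$ with premises $A_1,\dots,A_n$ and conclusion $C$ and every substitution $\sigma$: if $A_1\sigma,\dots,A_n\sigma$ are all tautologies of $\mathbf{M}$, then $C\sigma$ is a tautology of $\mathbf{M}$. -}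

module Defs where

open import Data.Nat using (ℕ)
open import Data.Fin using (Fin)
open import Data.Fin.Subset using (Subset; _∈_)
open import Data.Vec using (Vec; []; _∷_)
open import Data.List using (List)
open import Data.List.Relation.Unary.All using (All)
open import Data.Product using (_×_)

record Language : Set where
  field
    numConn : ℕ
    arity   : Fin numConn → ℕ

module _ (L : Language) where
  open Language L

  data Formula : Set where
    var : ℕ → Formula
    app : (c : Fin numConn) → Vec Formula (arity c) → Formula

  Substitution : Set
  Substitution = ℕ → Formula

  mutual
    subst : Substitution → Formula → Formula
    subst σ (var x)    = σ x
    subst σ (app c as) = app c (substs σ as)

    substs : ∀ {n} → Substitution → Vec Formula n → Vec Formula n
    substs σ []       = []
    substs σ (a ∷ as) = subst σ a ∷ substs σ as

  record Rule : Set where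
    constructor rule
    field
      premises   : List Formula
      conclusion : Formula

  record Calculus : Set where
    constructor calculus
    field
      axioms : List Formula
      rules  : List Rule

  record FiniteLogic : Set where
    field
      size       : ℕ
      designated : Subset size
      truthFn    : (c : Fin numConn) → Vec (Fin size) (arity c) → Fin size

  module _ (M : FiniteLogic) where
    open FiniteLogic M

    Valuation : Set
    Valuation = ℕ → Fin size

    mutual
      eval : Valuation → Formula → Fin size
      eval v (var x)    = v x
      eval v (app c as) = truthFn c (evals v as)

      evals : ∀ {n} → Valuation → Vec Formula n → Vec (Fin size) n
      evals v []       = []
      evals v (a ∷ as) = eval v a ∷ evals v as

    Tautology : Formula → Set
    Tautology F = (v : Valuation) → eval v F ∈ designated

  TSound : Calculus → FiniteLogic → Set
  TSound C M =
    All (Tautology M) (Calculus.axioms C) ×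
    All (λ r → (σ : Substitution) →
                 All (λ A → Tautology M (subst σ A)) (Rule.premises r) →
                 Tautology M (subst σ (Rule.conclusion r)))
        (Calculus.rules C)

-- Whether a rule fails under some substitution depends only on the
-- truth functions that the substituted formulas induce.  Renaming every
-- variable y of a counter-example to X_{v y}, where v is the falsifying
-- valuation, keeps the premises tautologies and the conclusion false, and
-- leaves formulas in the s variables X_0 … X_{s-1} (s the number of truth
-- values).  Such formulas denote s-ary truth functions; the set of those
-- that occur is the finite clone generated by the projections and the
-- connectives, computable by saturation.  Hence a rule is t-sound iff no
-- assignment of clone elements to its finitely many variables refutes it,
-- which is a finite search.
module Submission where

open import Defs
open import Data.Empty using (⊥-elim)
open import Data.Fin as Fin using (Fin; toℕ; funToFin; finToFun; combine; _≟_)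
open import Data.Fin.Properties
  using (any?; all?; toℕ-injective; toℕ-fromℕ<; toℕ<n; finToFun-funToFin; funToFin-finToFin)
open import Data.Fin.Subset using (Subset; _∈_; _∉_; _⊆_; _⊂_; ∣_∣; ⊥)
open import Data.Fin.Subset.Properties using (_∈?_; ∉⊥; ⊆-antisym; p⊂q⇒∣p∣<∣q∣; ∣p∣≤n)
open import Data.List using (List; []; _∷_)
import Data.List.Relation.Unary.All as List
open import Data.Nat using (ℕ; zero; suc; _<_; _≤_; _⊔_; _^_; NonZero; z≤n; s≤s)
open import Data.Nat.DivMod using (_mod_; m<n⇒m%n≡m)
open import Data.Nat.Properties using (≤-refl; ≤-trans; m≤m⊔n; m≤n⊔m; <-irrefl)
open import Data.Product using (∃; _×_; _,_; proj₁; proj₂)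
open import Data.Sum using (_⊎_; inj₁; inj₂)
open import Data.Vec using (Vec; []; _∷_; map; tabulate)
open import Data.Vec.Properties using (lookup∘tabulate; lookup⇒[]=; []=⇒lookup; map-∘; map-cong)
import Data.Vec.Relation.Unary.All as Vec
open import Data.Vec.Relation.Unary.All.Properties using (tabulate⁺)
open import Function using (_∘_; id; _⇔_; mk⇔)
open import Relation.Binary.PropositionalEquality as ≡
  using (_≡_; _≗_; refl; sym; trans; cong; cong₂; module ≡-Reasoning)
open import Relation.Nullary using (Dec; yes; no; ¬_; does)
open import Relation.Nullary.Decidable as Dec using (map′; ¬?; _×-dec_; _⊎-dec_; dec-true)
open import Relation.Unary using (Decidable)

∃-Vec? : ∀ {m} n {P : Vec (Fin m) n → Set} → Decidable P → Dec (∃ P)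
∃-Vec? zero    P? = map′ ([] ,_) (λ { ([] , p) → p }) (P? [])
∃-Vec? (suc n) P? =
  map′ (λ (x , xs , p) → x ∷ xs , p) (λ { (x ∷ xs , p) → x , xs , p })
       (any? λ x → ∃-Vec? n (P? ∘ (x ∷_)))

All-preimage : ∀ {A B : Set} {f : A → B} {n} {ys : Vec B n} →
               Vec.All (λ y → ∃ λ x → f x ≡ y) ys → ∃ λ xs → map f xs ≡ ys
All-preimage Vec.[] = [] , refl
All-preimage ((x , refl) Vec.∷ pre) with All-preimage pre
... | xs , refl = x ∷ xs , refl

lookupOr : ∀ {A : Set} {n} → Vec A n → A → ℕ → A
lookupOr []       d x       = d
lookupOr (a ∷ as) d zero    = a
lookupOr (a ∷ as) d (suc x) = lookupOr as d x

lookupOr-tabulate : ∀ {A : Set} n (g : ℕ → A) d {x} → x < n →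
                    lookupOr (tabulate {n = n} (g ∘ toℕ)) d x ≡ g x
lookupOr-tabulate (suc n) g d {zero}  _         = refl
lookupOr-tabulate (suc n) g d {suc x} (s≤s x<n) = lookupOr-tabulate n (g ∘ suc) d x<n

All-lookupOr : ∀ {A : Set} {P : A → Set} {n} {as : Vec A n} {d} →
               Vec.All P as → P d → ∀ x → P (lookupOr as d x)
All-lookupOr Vec.[]         pd x       = pd
All-lookupOr (pa Vec.∷ pas) pd zero    = pa
All-lookupOr (pa Vec.∷ pas) pd (suc x) = All-lookupOr pas pd x

toℕ-mod : ∀ {n} .{{_ : NonZero n}} (i : Fin n) → toℕ i mod n ≡ i
toℕ-mod i = toℕ-injective (trans (toℕ-fromℕ< _) (m<n⇒m%n≡m (toℕ<n i)))

funToFin-cong : ∀ {m n} {f g : Fin m → Fin n} → f ≗ g → funToFin f ≡ funToFin g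
funToFin-cong {zero}  f≗g = refl
funToFin-cong {suc m} f≗g = cong₂ combine (f≗g Fin.zero) (funToFin-cong (f≗g ∘ Fin.suc))

module _ {n} {P : Fin n → Set} (P? : Decidable P) where

  toSubset : Subset n
  toSubset = tabulate (does ∘ P?)

  ∈-toSubset⁺ : ∀ {x} → P x → x ∈ toSubset
  ∈-toSubset⁺ {x} px = lookup⇒[]= x _ (trans (lookup∘tabulate _ x) (dec-true (P? x) px))

  ∈-toSubset⁻ : ∀ {x} → x ∈ toSubset → P x
  ∈-toSubset⁻ {x} x∈ with P? x | trans (sym (lookup∘tabulate (does ∘ P?) x)) ([]=⇒lookup x∈)
  ... | yes px | _  = px
  ... | no _   | ()

module Saturation {n} (step : Subset n → Subset n) (step-inflationary : ∀ S → S ⊆ step S) where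

  Stable : Subset n → Set
  Stable S = step S ⊆ S

  stage : ℕ → Subset n
  stage zero    = ⊥
  stage (suc i) = step (stage i)

  saturation : Subset n
  saturation = stage (suc n)

  stable-step : ∀ {S} → Stable S → Stable (step S)
  stable-step {S} st = ≡.subst Stable (⊆-antisym (step-inflationary S) st) st

  stable-or-⊂ : ∀ S → Stable S ⊎ S ⊂ step S
  stable-or-⊂ S with any? (λ x → (x ∈? step S) ×-dec ¬? (x ∈? S))
  ... | yes (x , x∈ , x∉) = inj₂ (step-inflationary S , x , x∈ , x∉)
  ... | no ∄new = inj₁ stable
    where
    stable : Stable S
    stable {x} x∈ with x ∈? S
    ... | yes x∈S = x∈S
    ... | no  x∉S = ⊥-elim (∄new (x , x∈ , x∉S))

  stage-large-or-stable : ∀ i → i ≤ ∣ stage i ∣ ⊎ Stable (stage i)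
  stage-large-or-stable zero = inj₁ z≤n
  stage-large-or-stable (suc i) with stage-large-or-stable i | stable-or-⊂ (stage i)
  ... | inj₂ st     | _       = inj₂ (stable-step st)
  ... | inj₁ _      | inj₁ st = inj₂ (stable-step st)
  ... | inj₁ i≤∣S∣ | inj₂ S⊂ = inj₁ (≤-trans (s≤s i≤∣S∣) (p⊂q⇒∣p∣<∣q∣ S⊂))

  saturation-stable : Stable saturation
  saturation-stable with stage-large-or-stable (suc n)
  ... | inj₂ st    = st
  ... | inj₁ n<∣S∣ = ⊥-elim (<-irrefl refl (≤-trans n<∣S∣ (∣p∣≤n saturation)))

  saturation-induction : {Q : Fin n → Set} →
                     (∀ {S} → (∀ {x} → x ∈ S → Q x) → ∀ {x} → x ∈ step S → Q x) →
                     ∀ {x} → x ∈ saturation → Q x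
  saturation-induction {Q} step-preserves = stage⊆ (suc n)
    where
    stage⊆ : ∀ i {x} → x ∈ stage i → Q x
    stage⊆ zero    x∈ = ⊥-elim (∉⊥ x∈)
    stage⊆ (suc i)    = step-preserves (stage⊆ i)

module Syntax (L : Language) where

  mutual
    bound : Formula L → ℕ
    bound (var x)    = suc x
    bound (app c as) = bounds as

    bounds : ∀ {n} → Vec (Formula L) n → ℕ
    bounds []       = 0
    bounds (a ∷ as) = bound a ⊔ bounds as

  boundAll : List (Formula L) → ℕ
  boundAll []       = 0
  boundAll (A ∷ As) = bound A ⊔ boundAll As

  bound≤boundAll : ∀ As → List.All (λ A → bound A ≤ boundAll As) As
  bound≤boundAll []       = List.[]
  bound≤boundAll (A ∷ As) =
    m≤m⊔n _ _ List.∷ List.map (λ b → ≤-trans b (m≤n⊔m (bound A) _)) (bound≤boundAll As)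

module Semantics (L : Language) (M : FiniteLogic L) where
  open Language L
  open FiniteLogic M
  open Syntax L

  ev : Valuation L M → Formula L → Fin size
  ev = eval L M

  evs : ∀ {n} → Valuation L M → Vec (Formula L) n → Vec (Fin size) n
  evs = evals L M

  sb : Substitution L → Formula L → Formula L
  sb = Defs.subst L

  mutual
    eval-subst : ∀ v σ F → ev v (sb σ F) ≡ ev (λ x → ev v (σ x)) F
    eval-subst v σ (var x)    = refl
    eval-subst v σ (app c as) = cong (truthFn c) (evals-subst v σ as)

    evals-subst : ∀ {n} v σ (as : Vec (Formula L) n) →
                  evs v (substs L σ as) ≡ evs (λ x → ev v (σ x)) as
    evals-subst v σ []       = refl
    evals-subst v σ (a ∷ as) = cong₂ _∷_ (eval-subst v σ a) (evals-subst v σ as)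

  mutual
    eval-local : ∀ {K v w} F → bound F ≤ K → (∀ x → x < K → v x ≡ w x) → ev v F ≡ ev w F
    eval-local (var x)    x<K v≡w = v≡w x x<K
    eval-local (app c as) b   v≡w = cong (truthFn c) (evals-local as b v≡w)

    evals-local : ∀ {K v w n} (as : Vec (Formula L) n) → bounds as ≤ K →
                  (∀ x → x < K → v x ≡ w x) → evs v as ≡ evs w as
    evals-local []       b v≡w = refl
    evals-local (a ∷ as) b v≡w =
      cong₂ _∷_ (eval-local a (≤-trans (m≤m⊔n _ _) b) v≡w)
                (evals-local as (≤-trans (m≤n⊔m (bound a) _) b) v≡w)

  eval-cong : ∀ {v w} F → v ≗ w → ev v F ≡ ev w F
  eval-cong F v≗w = eval-local F ≤-refl (λ x _ → v≗w x)

  evals-map : ∀ {n} v (as : Vec (Formula L) n) → evs v as ≡ map (ev v) as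
  evals-map v []       = refl
  evals-map v (a ∷ as) = cong (_ ∷_) (evals-map v as)

  RuleSound : Rule L → Set
  RuleSound r = (σ : Substitution L) →
                List.All (λ A → Tautology L M (sb σ A)) (Rule.premises r) →
                Tautology L M (sb σ (Rule.conclusion r))

  axiom-rule-sound⇔tautology : ∀ A → RuleSound (rule [] A) ⇔ Tautology L M A
  axiom-rule-sound⇔tautology A = mk⇔
    (λ sound v → ≡.subst (_∈ designated) (eval-subst v var A) (sound var List.[] v))
    (λ taut σ _ v → ≡.subst (_∈ designated) (sym (eval-subst v σ A)) (taut _))

  tsound-without-valuations : ∀ C → ¬ Valuation L M → TSound L C M
  tsound-without-valuations C no-valuation =
    List.universal (λ _ v → ⊥-elim (no-valuation v)) _ ,
    List.universal (λ _ _ _ v → ⊥-elim (no-valuation v)) _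

-- An s-tuple of truth values is coded as an Arg, an s-ary truth function as
-- a Table; a formula is read as a function of X_0 … X_{s-1} by sending
-- variable y to the (y mod s)-th argument.
module Tables (L : Language) (M : FiniteLogic L) {{_ : NonZero (FiniteLogic.size M)}} where
  open Language L
  open FiniteLogic M
  open Semantics L M
  open ≡-Reasoning

  Arg : Set
  Arg = Fin (size ^ size)

  Table : Set
  Table = Fin (size ^ (size ^ size))

  apply : Table → Arg → Fin size
  apply = finToFun

  point : Arg → Valuation L M
  point a y = finToFun a (y mod size)

  restrict : Valuation L M → Arg
  restrict v = funToFin {size} {size} (v ∘ toℕ)

  restrict-point : ∀ a → restrict (point a) ≡ a
  restrict-point a = trans (funToFin-cong (cong (finToFun a) ∘ toℕ-mod)) (funToFin-finToFin {size} {size} a)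

  identity : Arg
  identity = funToFin {size} {size} id

  table : Formula L → Table
  table F = funToFin {size ^ size} {size} (λ a → ev (point a) F)

  apply-table : ∀ F a → apply (table F) a ≡ ev (point a) F
  apply-table F = finToFun-funToFin _

  projection : Fin size → Table
  projection i = funToFin {size ^ size} {size} (λ a → finToFun a i)

  lift : (c : Fin numConn) → Vec Table (arity c) → Table
  lift c ts = funToFin {size ^ size} {size} (λ a → truthFn c (map (λ t → apply t a) ts))

  table-app : ∀ c (as : Vec (Formula L) (arity c)) → table (app c as) ≡ lift c (map table as)
  table-app c as = funToFin-cong λ a → cong (truthFn c) (begin
    evs (point a) as                       ≡⟨ evals-map (point a) as ⟩
    map (ev (point a)) as                  ≡⟨ map-cong (λ F → sym (apply-table F a)) as ⟩
    map ((λ t → apply t a) ∘ table) as     ≡⟨ map-∘ _ _ as ⟩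
    map (λ t → apply t a) (map table as)   ∎)

  Realizable : Table → Set
  Realizable t = ∃ λ F → table F ≡ t

  Grow : Subset (size ^ (size ^ size)) → Table → Set
  Grow S t = t ∈ S
           ⊎ (∃ λ i → projection i ≡ t)
           ⊎ (∃ λ c → ∃ λ ts → Vec.All (_∈ S) ts × lift c ts ≡ t)

  grow? : ∀ S → Decidable (Grow S)
  grow? S t = t ∈? S
            ⊎-dec any? (λ i → projection i ≟ t)
            ⊎-dec any? (λ c → ∃-Vec? (arity c) λ ts → Vec.all? (_∈? S) ts ×-dec lift c ts ≟ t)

  open Saturation (λ S → toSubset (grow? S)) (λ S x∈ → ∈-toSubset⁺ (grow? S) (inj₁ x∈))

  grow-realizable : ∀ {S} → (∀ {t} → t ∈ S → Realizable t) →
                    ∀ {t} → t ∈ toSubset (grow? S) → Realizable t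
  grow-realizable {S} realizable t∈ with ∈-toSubset⁻ (grow? S) t∈
  ... | inj₁ t∈S                   = realizable t∈S
  ... | inj₂ (inj₁ (i , refl))     =
    var (toℕ i) , funToFin-cong (λ a → cong (finToFun a) (toℕ-mod i))
  ... | inj₂ (inj₂ (c , ts , ts∈S , refl)) with All-preimage (Vec.map realizable ts∈S)
  ...   | as , refl = app c as , table-app c as

  mutual
    table∈saturation : ∀ F → table F ∈ saturation
    table∈saturation (var x)    =
      saturation-stable (∈-toSubset⁺ (grow? saturation) (inj₂ (inj₁ (x mod size , refl))))
    table∈saturation (app c as) =
      saturation-stable (∈-toSubset⁺ (grow? saturation)
        (inj₂ (inj₂ (c , map table as , tables∈saturation as , sym (table-app c as)))))

    tables∈saturation : ∀ {n} (as : Vec (Formula L) n) → Vec.All (_∈ saturation) (map table as)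
    tables∈saturation []       = Vec.[]
    tables∈saturation (a ∷ as) = table∈saturation a Vec.∷ tables∈saturation as

  realizable? : Decidable Realizable
  realizable? t = map′ (saturation-induction grow-realizable)
                       (λ { (F , refl) → table∈saturation F })
                       (t ∈? saturation)

module RuleDecision (L : Language) (M : FiniteLogic L) {{_ : NonZero (FiniteLogic.size M)}}
                    (As : List (Formula L)) (C : Formula L) where
  open FiniteLogic M
  open Syntax L
  open Semantics L M
  open Tables L M
  open ≡-Reasoning

  K : ℕ
  K = boundAll (C ∷ As)

  -- Variables beyond the vector get the table of X_0, which is realizable.
  _at_ : ∀ {n} → Vec Table n → Arg → Valuation L M
  (ts at a) x = apply (lookupOr ts (table (var 0)) x) a

  Refutation : Vec Table K → Set
  Refutation ts = Vec.All Realizable ts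
                × List.All (λ A → ∀ a → ev (ts at a) A ∈ designated) As
                × ∃ λ a → ev (ts at a) C ∉ designated

  refutation? : Decidable Refutation
  refutation? ts = Vec.all? realizable? ts
                 ×-dec List.all? (λ A → all? λ a → ev (ts at a) A ∈? designated) As
                 ×-dec any? (λ a → ¬? (ev (ts at a) C ∈? designated))

  fold : Substitution L
  fold y = var (toℕ (y mod size))

  eval-fold : ∀ v F → ev v (sb fold F) ≡ ev (point (restrict v)) F
  eval-fold v F = trans (eval-subst v fold F)
                        (eval-cong F λ y → sym (finToFun-funToFin {size} {size} (v ∘ toℕ) (y mod size)))

  rename : Valuation L M → Substitution L
  rename v y = var (toℕ (v y))

  eval-rename : ∀ v a F → ev (point a) (sb (rename v) F) ≡ ev (finToFun a ∘ v) F
  eval-rename v a F = trans (eval-subst (point a) (rename v) F)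
                            (eval-cong F λ y → cong (finToFun a) (toℕ-mod (v y)))

  refutation⇒unsound : ∀ ts → Refutation ts → ¬ RuleSound (rule As C)
  refutation⇒unsound ts (realizable , As-hold , a , C-fails) sound =
    C-fails (≡.subst (λ b → ev (ts at b) C ∈ designated) (restrict-point a)
                     (≡.subst (_∈ designated) (instance-at (point a) C) (sound σ As-taut (point a))))
    where
    witness : ℕ → Formula L
    witness x = proj₁ (All-lookupOr realizable (var 0 , refl) x)

    σ : Substitution L
    σ x = sb fold (witness x)

    instance-at : ∀ v F → ev v (sb σ F) ≡ ev (ts at restrict v) F
    instance-at v F = trans (eval-subst v σ F) (eval-cong F λ x → begin
      ev v (sb fold (witness x))               ≡⟨ eval-fold v (witness x) ⟩
      ev (point (restrict v)) (witness x)      ≡⟨ apply-table (witness x) (restrict v) ⟨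
      apply (table (witness x)) (restrict v)   ≡⟨ cong (λ t → apply t (restrict v))
                                                       (proj₂ (All-lookupOr realizable (var 0 , refl) x)) ⟩
      (ts at restrict v) x                     ∎)

    As-taut : List.All (λ A → Tautology L M (sb σ A)) As
    As-taut = List.map (λ {A} holds v →
                ≡.subst (_∈ designated) (sym (instance-at v A)) (holds (restrict v))) As-hold

  ∄refutation⇒sound : ¬ ∃ Refutation → RuleSound (rule As C)
  ∄refutation⇒sound ∄ref σ As-taut v with ev v (sb σ C) ∈? designated
  ... | yes C-holds = C-holds
  ... | no  C-fails = ⊥-elim (∄ref (ts , realizable , As-hold , identity , C-fails-at-id))
    where
    instances : ℕ → Formula L
    instances x = sb (rename v) (σ x)

    ts : Vec Table K
    ts = tabulate (table ∘ instances ∘ toℕ)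

    realizable : Vec.All Realizable ts
    realizable = tabulate⁺ (λ i → instances (toℕ i) , refl)

    agree : ∀ a x → x < K → (ts at a) x ≡ ev (finToFun a ∘ v) (σ x)
    agree a x x<K = begin
      apply (lookupOr ts (table (var 0)) x) a   ≡⟨ cong (λ t → apply t a) (lookupOr-tabulate K _ _ x<K) ⟩
      apply (table (instances x)) a             ≡⟨ apply-table (instances x) a ⟩
      ev (point a) (instances x)                ≡⟨ eval-rename v a (σ x) ⟩
      ev (finToFun a ∘ v) (σ x)                 ∎

    at-instance : ∀ a F → bound F ≤ K → ev (ts at a) F ≡ ev (finToFun a ∘ v) (sb σ F)
    at-instance a F F≤K = trans (eval-local F F≤K (agree a)) (sym (eval-subst _ σ F))

    C≤K : bound C ≤ K
    C≤K = List.head (bound≤boundAll (C ∷ As))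

    As-hold : List.All (λ A → ∀ a → ev (ts at a) A ∈ designated) As
    As-hold = List.zipWith
      (λ { {A} (A≤K , taut) a → ≡.subst (_∈ designated) (sym (at-instance a A A≤K)) (taut _) })
      (List.tail (bound≤boundAll (C ∷ As)) , As-taut)

    C-fails-at-id : ev (ts at identity) C ∉ designated
    C-fails-at-id holds = C-fails (≡.subst (_∈ designated)
      (trans (at-instance identity C C≤K)
             (eval-cong (sb σ C) (finToFun-funToFin {size} {size} id ∘ v))) holds)

  rule-sound? : Dec (RuleSound (rule As C))
  rule-sound? = map′ ∄refutation⇒sound
                     (λ sound (ts , ref) → refutation⇒unsound ts ref sound)
                     (¬? (∃-Vec? K refutation?))

module _ (L : Language) (M : FiniteLogic L) {{_ : NonZero (FiniteLogic.size M)}} where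
  open Semantics L M

  tautology? : Decidable (Tautology L M)
  tautology? A = Dec.map (axiom-rule-sound⇔tautology A) (RuleDecision.rule-sound? L M [] A)

  tsound? : ∀ C → Dec (TSound L C M)
  tsound? (calculus axioms rules) =
    List.all? tautology? axioms ×-dec List.all? (λ { (rule As C) → RuleDecision.rule-sound? L M As C }) rules

nonZero-or-empty : ∀ n → NonZero n ⊎ ¬ Fin n
nonZero-or-empty zero    = inj₂ λ ()
nonZero-or-empty (suc n) = inj₁ _

proposition5 : (L : Language) (C : Calculus L) (M : FiniteLogic L) →
               Dec (TSound L C M)
proposition5 L C M with nonZero-or-empty (FiniteLogic.size M)
... | inj₁ nonZero = tsound? L M {{nonZero}} C
... | inj₂ empty   = yes (Semantics.tsound-without-valuations L M C (λ v → empty (v 0)))
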